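{- Let $G$ and $H$ be graphs and let $p$ be a positive integer. Then $$(G\,\square\, H)^{[\natural p]}=\biguplus_{i=0}^{p} \left(G^{[\natural i]}\times H^{[\natural p-i]}\right)\,.$$ Equivalently, $$(G\,\square\, H)^{[\natural p]}=\biguplus_{i=1}^{p-1} \left(G^{[\natural i]}\times H^{[\natural p-i]}\right)\uplus \left(G^{[\natural p]}\,\square\, H^{[\natural p]}\right)\,.$$
   Context: For a graph $G$ and a positive integer $p$, the exact distance-$p$ graph $G^{[\natural p]}$ has vertex set $V(G)$, two vertices being adjacent iff their distance in $G$ equals exactly $p$. $G^{[\natural 0]}$ is the graph on $V(G)$ with a loop at each vertex and no other edges. If $G$ and $H$ are graphs on the same vertex set, $G\uplus H$ is the graph on that vertex set with edge set $E(G)\cup E(H)$ (and $\biguplus$ denotes the iterated version). All products have vertex set $V(G)\times V(H)$. In the Cartesian product $G\,\square\,H$, $(g_1,h_1)(g_2,h_2)$ is an edge iff either $g_1g_2\in E(G)$ and $h_1=h_2$, or $g_1=g_2$ and $h_1h_2\in E(H)$. In the direct product $G\times H$, $(g_1,h_1)(g_2,h_2)$ is an edge iff $g_1g_2\in E(G)$ and $h_1h_2\in E(H)$ (where a loop at $g$ counts as $gg\in E(G)$). Equalities are equalities of graphs on the common vertex set $V(G)\times V(H)$. -}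

module Defs where

open import Level using (0ℓ)
open import Data.Nat using (ℕ; zero; suc; _<_; _≤_; _∸_; _+_)
open import Data.Fin using (Fin)
open import Data.Product using (_×_; _,_; Σ; ∃)
open import Data.Sum using (_⊎_)
open import Relation.Nullary using (¬_)
open import Relation.Binary.PropositionalEquality using (_≡_)

-- A "graph on vertex set V" is given by its edge relation (loops allowed,
-- needed e.g. for G^[♮0]).  Edges are unordered: we only ever compare
-- relations that are symmetric.
EdgeRel : Set → Set₁
EdgeRel V = V → V → Set

record Graph : Set₁ where
  field
    n      : ℕ
    _~_    : EdgeRel (Fin n)
    sym    : ∀ {x y} → x ~ y → y ~ x
    irrefl : ∀ {x} → ¬ (x ~ x)

open Graph public

data Walk {V : Set} (E : EdgeRel V) : V → V → ℕ → Set where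
  [] : ∀ {x} → Walk E x x zero
  _∷_ : ∀ {x y z k} → E x y → Walk E y z k → Walk E x z (suc k)

Dist : {V : Set} → EdgeRel V → V → V → ℕ → Set
Dist E x y k = Walk E x y k × (∀ j → j < k → ¬ Walk E x y j)

exact : {V : Set} → EdgeRel V → ℕ → EdgeRel V
exact E zero x y = x ≡ y
exact E (suc p) x y = Dist E x y (suc p)

_^♮_ : (G : Graph) → ℕ → EdgeRel (Fin (n G))
G ^♮ p = exact (_~_ G) p

_□_ : {V W : Set} → EdgeRel V → EdgeRel W → EdgeRel (V × W)
(E □ F) (g₁ , h₁) (g₂ , h₂) = (E g₁ g₂ × h₁ ≡ h₂) ⊎ (g₁ ≡ g₂ × F h₁ h₂)

_⊠_ : {V W : Set} → EdgeRel V → EdgeRel W → EdgeRel (V × W)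
(E ⊠ F) (g₁ , h₁) (g₂ , h₂) = E g₁ g₂ × F h₁ h₂

_⊎ᴱ_ : {V : Set} → EdgeRel V → EdgeRel V → EdgeRel V
(E ⊎ᴱ F) x y = E x y ⊎ F x y

⨄[_to_] : {V : Set} → ℕ → ℕ → (ℕ → EdgeRel V) → EdgeRel V
⨄[ a to b ] E x y = Σ ℕ λ i → a ≤ i × i ≤ b × E i x y

_≐_ : {V : Set} → EdgeRel V → EdgeRel V → Set
E ≐ F = ∀ x y → (E x y → F x y) × (F x y → E x y)

module Submission where

open import Defs hiding (sym)
open import Data.Nat using (ℕ; _∸_; _≥_; zero; suc; _+_; _<_; _≤_; z≤n; s≤s)
open import Data.Nat.Properties
  using ( _<?_; ≮⇒≥; <⇒≱; +-suc; +-mono-≤; +-monoˡ-<; +-monoʳ-<; m≤m+n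
        ; m+n∸m≡n; m+[n∸m]≡n; n∸n≡0; m≤n⇒m<n∨m≡n; m≤n⇒m≤1+n; ≤-refl)
open import Data.Empty using (⊥-elim)
open import Data.Product using (_×_; _,_; ∃₂)
open import Data.Sum using (_⊎_; inj₁; inj₂)
open import Relation.Nullary using (¬_; yes; no)
open import Relation.Binary.PropositionalEquality using (_≡_; refl; sym; trans; cong; subst)

-- A walk in E □ F projects to walks in E and F whose lengths add up, and any
-- two walks in E and F combine into one in E □ F.  Hence distances in E □ F
-- are sums of distances, so an edge of the exact distance-p graph of E □ F is
-- exactly a pair of edges of the exact distance-i and distance-(p − i) graphs.
-- The second form only separates the terms i = p and i = 0, which together
-- make up the Cartesian product of the exact distance-p graphs.

infixr 5 _≐-∘_

_≐-∘_ : {V : Set} {E F D : EdgeRel V} → E ≐ F → F ≐ D → E ≐ D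
(E≐F ≐-∘ F≐D) x y with E≐F x y | F≐D x y
... | E⇒F , F⇒E | F⇒D , D⇒F = (λ e → F⇒D (E⇒F e)) , (λ d → F⇒E (D⇒F d))

⊎ᴱ-congʳ : {V : Set} {E F F′ : EdgeRel V} → F ≐ F′ → (E ⊎ᴱ F) ≐ (E ⊎ᴱ F′)
⊎ᴱ-congʳ F≐F′ x y with F≐F′ x y
... | F⇒F′ , F′⇒F = (λ { (inj₁ e) → inj₁ e ; (inj₂ f) → inj₂ (F⇒F′ f) })
                  , (λ { (inj₁ e) → inj₁ e ; (inj₂ f) → inj₂ (F′⇒F f) })

⨄-separate-ends : {V : Set} (D : ℕ → EdgeRel V) (q : ℕ) →
                  ⨄[ 0 to suc q ] D ≐ (⨄[ 1 to q ] D ⊎ᴱ (D (suc q) ⊎ᴱ D 0))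
⨄-separate-ends D q x y = to , from
  where
  to : ⨄[ 0 to suc q ] D x y → (⨄[ 1 to q ] D ⊎ᴱ (D (suc q) ⊎ᴱ D 0)) x y
  to (zero  , _ , _     , d) = inj₂ (inj₂ d)
  to (suc i , _ , s≤s i≤q , d) with m≤n⇒m<n∨m≡n i≤q
  ... | inj₁ i<q  = inj₁ (suc i , s≤s z≤n , i<q , d)
  ... | inj₂ refl = inj₂ (inj₁ d)
  from : (⨄[ 1 to q ] D ⊎ᴱ (D (suc q) ⊎ᴱ D 0)) x y → ⨄[ 0 to suc q ] D x y
  from (inj₁ (i , _ , i≤q , d)) = i , z≤n , m≤n⇒m≤1+n i≤q , d
  from (inj₂ (inj₁ d))          = suc q , z≤n , ≤-refl , d
  from (inj₂ (inj₂ d))          = zero , z≤n , z≤n , d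

module _ {V : Set} {E : EdgeRel V} where

  exact⇒Dist : ∀ k {x y} → exact E k x y → Dist E x y k
  exact⇒Dist zero    refl = [] , λ _ ()
  exact⇒Dist (suc k) d    = d

  Dist⇒exact : ∀ k {x y} → Dist E x y k → exact E k x y
  Dist⇒exact zero    ([] , _) = refl
  Dist⇒exact (suc k) d        = d

  Dist-≤-Walk : ∀ {x y k j} → Dist E x y k → Walk E x y j → k ≤ j
  Dist-≤-Walk {j = j} (_ , shortest) w with j <? _
  ... | yes j<k = ⊥-elim (shortest j j<k w)
  ... | no  j≮k = ≮⇒≥ j≮k

module _ {V W : Set} {E : EdgeRel V} {F : EdgeRel W} where

  Walk-□-split : ∀ {g₁ h₁ g₂ h₂ k} → Walk (E □ F) (g₁ , h₁) (g₂ , h₂) k →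
                 ∃₂ λ a b → a + b ≡ k × Walk E g₁ g₂ a × Walk F h₁ h₂ b
  Walk-□-split [] = 0 , 0 , refl , [] , []
  Walk-□-split (inj₁ (e , refl) ∷ w) with Walk-□-split w
  ... | a , b , a+b≡k , wE , wF = suc a , b , cong suc a+b≡k , e ∷ wE , wF
  Walk-□-split (inj₂ (refl , f) ∷ w) with Walk-□-split w
  ... | a , b , a+b≡k , wE , wF = a , suc b , trans (+-suc a b) (cong suc a+b≡k) , wE , f ∷ wF

  Walk-□-join : ∀ {g₁ h₁ g₂ h₂ a b} → Walk E g₁ g₂ a → Walk F h₁ h₂ b →
                Walk (E □ F) (g₁ , h₁) (g₂ , h₂) (a + b)
  Walk-□-join []       []       = []
  Walk-□-join []       (f ∷ wF) = inj₂ (refl , f) ∷ Walk-□-join [] wF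
  Walk-□-join (e ∷ wE) wF       = inj₁ (e , refl) ∷ Walk-□-join wE wF

  Dist-□-split : ∀ {g₁ h₁ g₂ h₂ k} → Dist (E □ F) (g₁ , h₁) (g₂ , h₂) k →
                 ∃₂ λ a b → a + b ≡ k × Dist E g₁ g₂ a × Dist F h₁ h₂ b
  Dist-□-split (w , shortest) with Walk-□-split w
  ... | a , b , refl , wE , wF =
    a , b , refl
      , (wE , λ j j<a wE′ → shortest (j + b) (+-monoˡ-< b j<a) (Walk-□-join wE′ wF))
      , (wF , λ j j<b wF′ → shortest (a + j) (+-monoʳ-< a j<b) (Walk-□-join wE wF′))

  Dist-□-join : ∀ {g₁ h₁ g₂ h₂ a b} → Dist E g₁ g₂ a → Dist F h₁ h₂ b →
                Dist (E □ F) (g₁ , h₁) (g₂ , h₂) (a + b)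
  Dist-□-join {g₁} {h₁} {g₂} {h₂} {a} {b} dE@(wE , _) dF@(wF , _) =
    Walk-□-join wE wF , no-shorter
    where
    no-shorter : ∀ j → j < a + b → ¬ Walk (E □ F) (g₁ , h₁) (g₂ , h₂) j
    no-shorter j j<a+b w with Walk-□-split w
    ... | a′ , b′ , refl , wE′ , wF′ =
      <⇒≱ j<a+b (+-mono-≤ (Dist-≤-Walk dE wE′) (Dist-≤-Walk dF wF′))

  exact-□≐⨄ : ∀ p → exact (E □ F) p ≐ ⨄[ 0 to p ] (λ i → exact E i ⊠ exact F (p ∸ i))
  exact-□≐⨄ p (g₁ , h₁) (g₂ , h₂) = to , from
    where
    to : exact (E □ F) p (g₁ , h₁) (g₂ , h₂) →
         ⨄[ 0 to p ] (λ i → exact E i ⊠ exact F (p ∸ i)) (g₁ , h₁) (g₂ , h₂)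
    to d with Dist-□-split (exact⇒Dist p d)
    ... | a , b , refl , dE , dF =
      a , z≤n , m≤m+n a b , Dist⇒exact a dE
        , Dist⇒exact (a + b ∸ a) (subst (Dist F h₁ h₂) (sym (m+n∸m≡n a b)) dF)
    from : ⨄[ 0 to p ] (λ i → exact E i ⊠ exact F (p ∸ i)) (g₁ , h₁) (g₂ , h₂) →
           exact (E □ F) p (g₁ , h₁) (g₂ , h₂)
    from (i , _ , i≤p , eE , eF) =
      Dist⇒exact p (subst (Dist (E □ F) _ _) (m+[n∸m]≡n i≤p)
        (Dist-□-join (exact⇒Dist i eE) (exact⇒Dist (p ∸ i) eF)))

  exact-□-ends : ∀ p → ((exact E p ⊠ exact F (p ∸ p)) ⊎ᴱ (exact E 0 ⊠ exact F p))
                       ≐ (exact E p □ exact F p)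
  exact-□-ends p (g₁ , h₁) (g₂ , h₂) = to , from
    where
    to : ((exact E p ⊠ exact F (p ∸ p)) ⊎ᴱ (exact E 0 ⊠ exact F p)) (g₁ , h₁) (g₂ , h₂) →
         (exact E p □ exact F p) (g₁ , h₁) (g₂ , h₂)
    to (inj₁ (eE , eF)) = inj₁ (eE , subst (λ k → exact F k h₁ h₂) (n∸n≡0 p) eF)
    to (inj₂ e)         = inj₂ e
    from : (exact E p □ exact F p) (g₁ , h₁) (g₂ , h₂) →
           ((exact E p ⊠ exact F (p ∸ p)) ⊎ᴱ (exact E 0 ⊠ exact F p)) (g₁ , h₁) (g₂ , h₂)
    from (inj₁ (eE , h₁≡h₂)) = inj₁ (eE , subst (λ k → exact F k h₁ h₂) (sym (n∸n≡0 p)) h₁≡h₂)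
    from (inj₂ e)            = inj₂ e

theorem2p2 : (G H : Graph) (p : ℕ) → p ≥ 1 →
    (exact (_~_ G □ _~_ H) p ≐ ⨄[ 0 to p ] (λ i → (G ^♮ i) ⊠ (H ^♮ (p ∸ i))))
    × (exact (_~_ G □ _~_ H) p ≐
        (⨄[ 1 to p ∸ 1 ] (λ i → (G ^♮ i) ⊠ (H ^♮ (p ∸ i))) ⊎ᴱ ((G ^♮ p) □ (H ^♮ p))))
theorem2p2 G H (suc q) _ =
  exact-□≐⨄ (suc q)
  , exact-□≐⨄ (suc q)
    ≐-∘ ⨄-separate-ends (λ i → (G ^♮ i) ⊠ (H ^♮ (suc q ∸ i))) q
    ≐-∘ ⊎ᴱ-congʳ (exact-□-ends (suc q))
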